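{- Let $A$ be an alphabet with $q\geq 2$ letters, and for $n\geq 1$ let $M_q(n)=q^{ -n}\sum_{w\in A^n}P(w)$, where $P(w)$ is the number of distinct nonempty palindromes occurring as factors of $w$. Then for every $n\geq 1$, $$M_q(n)\leq \frac{q^{ -(n-1)/2}(q+3)+2n(q-1)+q^3-2q^2-2q-1}{(q-1)^2}\quad\text{if } n \text{ is odd},$$ $$M_q(n)\leq \frac{q^{ -n/2}(3q+1)+2n(q-1)+q^3-2q^2-2q-1}{(q-1)^2}\quad\text{if } n \text{ is even}.$$
   Context: $A^n$ is the set of words of length $n$ over $A$. A word is a palindrome if it equals its reversal; a factor is a block of consecutive letters. $P(w)$ counts distinct palindromic nonempty factors of $w$ (each counted once regardless of the number of occurrences). -}

module Defs where

open import Data.Nat as ℕ using (ℕ; zero; suc; _^_)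
open import Data.Integer as ℤ using (ℤ; +_)
open import Data.Rational as ℚ using (ℚ; _/_; _+_; _*_)
open import Data.Fin using (Fin)
import Data.Fin.Properties as FinP
open import Data.List using (List; []; _∷_; map; concatMap; inits; tails; filter; deduplicate; length; reverse; allFin)
open import Data.List.Properties using (≡-dec)
open import Data.Nat.ListAction using (sum)
open import Data.Nat.Properties using (m^n≢0)
open import Data.Vec as Vec using (Vec; toList)
open import Relation.Nullary using (¬_; Dec; yes; no)
open import Relation.Unary using (Decidable)
open import Relation.Binary.PropositionalEquality using (_≡_)

Word : ℕ → Set
Word q = List (Fin q)

allWords : (q n : ℕ) → List (Vec (Fin q) n)
allWords q zero = Vec.[] ∷ []
allWords q (suc n) = concatMap (λ a → map (a Vec.∷_) (allWords q n)) (allFin q)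

_≟w_ : ∀ {q} → (u v : Word q) → Dec (u ≡ v)
_≟w_ = ≡-dec FinP._≟_

NonEmpty : ∀ {q} → Word q → Set
NonEmpty w = ¬ (w ≡ [])

nonEmpty? : ∀ {q} → Decidable (NonEmpty {q})
nonEmpty? [] = no (λ f → f _≡_.refl)
nonEmpty? (x ∷ w) = yes (λ ())

IsPalindrome : ∀ {q} → Word q → Set
IsPalindrome w = w ≡ reverse w

isPalindrome? : ∀ {q} → Decidable (IsPalindrome {q})
isPalindrome? w = w ≟w reverse w

factors : ∀ {q} → Word q → List (Word q)
factors w = filter nonEmpty? (concatMap inits (tails w))

P : ∀ {q} → Word q → ℕ
P w = length (deduplicate _≟w_ (filter isPalindrome? (factors w)))

totalP : (q n : ℕ) → ℕ
totalP q n = sum (map (λ w → P (toList w)) (allWords q n))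

-- M_q(n) = q^{-n} Σ_{w ∈ A^n} P(w)   (junk value 0 for q = 0)
M : ℕ → ℕ → ℚ
M zero n = ℚ.0ℚ
M (suc k) n = + totalP (suc k) n / (suc k ^ n)
  where instance _ = m^n≢0 (suc k) n

linPart : ℕ → ℕ → ℤ
linPart q n = (+ 2) ℤ.* (+ n) ℤ.* (+ q ℤ.- + 1)
  ℤ.+ (+ q) ℤ.^ 3 ℤ.- (+ 2) ℤ.* (+ q) ℤ.^ 2 ℤ.- (+ 2) ℤ.* (+ q) ℤ.- + 1
  where import Data.Integer as ℤ

-- bound for odd n = 2m+1 :
--  (q^{-(n-1)/2}(q+3) + 2n(q-1) + q^3-2q^2-2q-1) / (q-1)^2,   (n-1)/2 = m
-- (junk value 0 for q < 2)
boundOdd : (q m : ℕ) → ℚ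
boundOdd zero m = ℚ.0ℚ
boundOdd (suc zero) m = ℚ.0ℚ
boundOdd (suc (suc k)) m =
  ((+ (q ℕ.+ 3) / (q ^ m)) + (linPart q (suc (2 ℕ.* m)) / 1))
    * (+ 1 / (suc k ^ 2))
  where
  q = suc (suc k)
  instance _ = m^n≢0 q m
  instance _ = m^n≢0 (suc k) 2

-- bound for even n = 2m :
--  (q^{-n/2}(3q+1) + 2n(q-1) + q^3-2q^2-2q-1) / (q-1)^2,   n/2 = m
boundEven : (q m : ℕ) → ℚ
boundEven zero m = ℚ.0ℚ
boundEven (suc zero) m = ℚ.0ℚ
boundEven (suc (suc k)) m =
  ((+ (3 ℕ.* q ℕ.+ 1) / (q ^ m)) + (linPart q (2 ℕ.* m) / 1))
    * (+ 1 / (suc k ^ 2))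
  where
  q = suc (suc k)
  instance _ = m^n≢0 q m
  instance _ = m^n≢0 (suc k) 2

module Submission where

-- Every distinct palindromic factor of w is a letter or a palindrome of length ≥ 2 occurring
-- at some position, so P(w) ≤ q + (number of occurrences of long palindromes in w).  Summing
-- over A^N, the occurrences at the first position are long palindromic prefixes, and at most
-- q^(N - ⌊ℓ/2⌋) words of length N start with a palindrome of length ℓ, since its first ⌊ℓ/2⌋
-- letters mirror the next ones (count through the map w ↦ drop ⌊ℓ/2⌋ w, injective on them).
-- Hence Σ_{w ∈ A^N} P(w) ≤ q^(N+1) + T(N), where T(N) = q·T(N-1) + Σ_{2≤ℓ≤N} q^(N-⌊ℓ/2⌋).

open import Defs
open import Data.Nat using (ℕ)

module Counting where

  open import Data.Nat using (ℕ; zero; suc; _+_; _*_; _^_; _∸_; _⊓_; _<_; _≤_; z≤n; s≤s; ⌊_/2⌋; ⌈_/2⌉)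
  open import Data.Nat.Properties
  open import Algebra.Properties.CommutativeSemigroup +-commutativeSemigroup using (interchange)
  open import Data.Nat.ListAction using (sum)
  open import Data.Nat.ListAction.Properties using (sum-++)
  open import Data.List using (List; []; _∷_; map; _++_; length; reverse; filter; tabulate; allFin; concatMap; inits; tails; take; drop; deduplicate)
  open import Data.List.Properties using (map-++; map-∘; length-map; length-++; length-take; length-drop; length-reverse; length-tabulate; take-take; take-drop; take++drop≡id; reverse-++; filter-++; map-tabulate; ∷-injectiveˡ; ∷-injectiveʳ)
  open import Data.Vec using (toList)
  open import Data.Vec.Properties using (length-toList)
  open import Data.Fin using (Fin)
  import Data.Fin as Fin
  import Data.Fin.Properties as FinP
  open import Data.Product using (Σ; _×_; _,_)
  open import Data.Empty using (⊥; ⊥-elim)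
  open import Function using (_∘_)
  open import Relation.Nullary using (¬_; Dec; yes; no)
  open import Relation.Nullary.Decidable using (_×-dec_)
  open import Relation.Unary using (Decidable)
  open import Relation.Binary.PropositionalEquality
  open import Relation.Binary.Definitions using (DecidableEquality)
  open import Data.List.Membership.Propositional using (_∈_)
  open import Data.List.Membership.Propositional.Properties using (∈-filter⁺; ∈-filter⁻; ∈-map⁺; ∈-allFin; ∈-++⁺ˡ; ∈-++⁺ʳ; ∈-deduplicate⁻)
  open import Data.List.Relation.Unary.Unique.DecPropositional.Properties using (deduplicate-!)
  open import Data.List.Relation.Unary.Any using (here; there)
  import Data.List.Relation.Unary.All as All
  open import Data.List.Relation.Unary.AllPairs using (AllPairs; []; _∷_)

  𝟙 : ∀ {p} {P : Set p} → Dec P → ℕ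
  𝟙 (yes _) = 1
  𝟙 (no _) = 0

  𝟙-cong : ∀ {p r} {P : Set p} {R : Set r} → (P → R) → (R → P) →
           (P? : Dec P) (R? : Dec R) → 𝟙 P? ≡ 𝟙 R?
  𝟙-cong f g (yes p) (yes r) = refl
  𝟙-cong f g (yes p) (no ¬r) = ⊥-elim (¬r (f p))
  𝟙-cong f g (no ¬p) (yes r) = ⊥-elim (¬p (g r))
  𝟙-cong f g (no ¬p) (no ¬r) = refl

  𝟙-false : ∀ {p} {P : Set p} → ¬ P → (P? : Dec P) → 𝟙 P? ≡ 0
  𝟙-false ¬p (yes p) = ⊥-elim (¬p p)
  𝟙-false ¬p (no _) = refl

  𝟙-true : ∀ {p} {P : Set p} → P → (P? : Dec P) → 𝟙 P? ≡ 1
  𝟙-true p (yes _) = refl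
  𝟙-true p (no ¬p) = ⊥-elim (¬p p)

  𝟙-witness : ∀ {p} {P : Set p} (P? : Dec P) → 0 < 𝟙 P? → P
  𝟙-witness (yes p) _ = p

  𝟙-× : ∀ {p r} {P : Set p} {R : Set r} (P? : Dec P) (R? : Dec R) →
        𝟙 P? * 𝟙 R? ≡ 𝟙 (P? ×-dec R?)
  𝟙-× (yes _) (yes _) = refl
  𝟙-× (yes _) (no _) = refl
  𝟙-× (no _) (yes _) = refl
  𝟙-× (no _) (no _) = refl

  𝟙-mono : ∀ {p r} {P : Set p} {R : Set r} → (P → R) → (P? : Dec P) (R? : Dec R) → 𝟙 P? ≤ 𝟙 R?
  𝟙-mono f (yes p) R? = ≤-reflexive (sym (𝟙-true (f p) R?))
  𝟙-mono f (no _) R? = z≤n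

  module _ {a} {A : Set a} where

    sum-map-cong : ∀ {f g : A → ℕ} → (∀ x → f x ≡ g x) → ∀ xs → sum (map f xs) ≡ sum (map g xs)
    sum-map-cong f≡g [] = refl
    sum-map-cong f≡g (x ∷ xs) = cong₂ _+_ (f≡g x) (sum-map-cong f≡g xs)

    sum-map-mono : ∀ {f g : A → ℕ} → (∀ x → f x ≤ g x) → ∀ xs → sum (map f xs) ≤ sum (map g xs)
    sum-map-mono f≤g [] = z≤n
    sum-map-mono f≤g (x ∷ xs) = +-mono-≤ (f≤g x) (sum-map-mono f≤g xs)

    sum-map-+ : ∀ (f g : A → ℕ) xs → sum (map (λ x → f x + g x) xs) ≡ sum (map f xs) + sum (map g xs)
    sum-map-+ f g [] = refl
    sum-map-+ f g (x ∷ xs) =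
      trans (cong (f x + g x +_) (sum-map-+ f g xs)) (interchange (f x) (g x) _ _)

    sum-map-const : ∀ c (xs : List A) → sum (map (λ _ → c) xs) ≡ length xs * c
    sum-map-const c [] = refl
    sum-map-const c (x ∷ xs) = cong (c +_) (sum-map-const c xs)

    sum-map-*ˡ : ∀ c (f : A → ℕ) xs → c * sum (map f xs) ≡ sum (map (λ x → c * f x) xs)
    sum-map-*ˡ c f [] = *-zeroʳ c
    sum-map-*ˡ c f (x ∷ xs) = trans (*-distribˡ-+ c (f x) _) (cong (c * f x +_) (sum-map-*ˡ c f xs))

    sum-map-pos : ∀ (f : A → ℕ) xs → 0 < sum (map f xs) → Σ A (λ x → 0 < f x)
    sum-map-pos f [] ()
    sum-map-pos f (x ∷ xs) pos with f x in fx
    ... | suc _ = x , subst (0 <_) (sym fx) (s≤s z≤n)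
    ... | zero = sum-map-pos f xs pos

    length-filter-𝟙 : ∀ {p} {P : A → Set p} (P? : Decidable P) xs →
                      length (filter P? xs) ≡ sum (map (λ x → 𝟙 (P? x)) xs)
    length-filter-𝟙 P? [] = refl
    length-filter-𝟙 P? (x ∷ xs) with P? x
    ... | yes _ = cong suc (length-filter-𝟙 P? xs)
    ... | no _ = length-filter-𝟙 P? xs

  module _ {a b} {A : Set a} {B : Set b} where

    sum-map-concatMap : ∀ (g : B → ℕ) (h : A → List B) xs →
      sum (map g (concatMap h xs)) ≡ sum (map (λ x → sum (map g (h x))) xs)
    sum-map-concatMap g h [] = refl
    sum-map-concatMap g h (x ∷ xs) =
      trans (cong sum (map-++ g (h x) _))
            (trans (sum-++ (map g (h x)) _) (cong (_ +_) (sum-map-concatMap g h xs)))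

    sum-map-swap : ∀ (g : A → B → ℕ) xs ys →
      sum (map (λ x → sum (map (g x) ys)) xs) ≡ sum (map (λ y → sum (map (λ x → g x y) xs)) ys)
    sum-map-swap g [] ys = sym (trans (sum-map-const 0 ys) (*-zeroʳ (length ys)))
    sum-map-swap g (x ∷ xs) ys =
      trans (cong (_ +_) (sum-map-swap g xs ys)) (sym (sum-map-+ (g x) (λ y → sum (map (λ x → g x y) xs)) ys))

  sumBelow : (ℕ → ℕ) → ℕ → ℕ
  sumBelow f zero = 0
  sumBelow f (suc n) = f 0 + sumBelow (f ∘ suc) n

  sumBelow-mono : ∀ n {f g : ℕ → ℕ} → (∀ ℓ → ℓ < n → f ℓ ≤ g ℓ) → sumBelow f n ≤ sumBelow g n
  sumBelow-mono zero f≤g = z≤n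
  sumBelow-mono (suc n) f≤g = +-mono-≤ (f≤g 0 (s≤s z≤n)) (sumBelow-mono n (λ ℓ ℓ<n → f≤g (suc ℓ) (s≤s ℓ<n)))

  sumBelow-cong : ∀ n {f g : ℕ → ℕ} → (∀ ℓ → ℓ < n → f ℓ ≡ g ℓ) → sumBelow f n ≡ sumBelow g n
  sumBelow-cong zero f≡g = refl
  sumBelow-cong (suc n) f≡g = cong₂ _+_ (f≡g 0 (s≤s z≤n)) (sumBelow-cong n (λ ℓ ℓ<n → f≡g (suc ℓ) (s≤s ℓ<n)))

  sumBelow-*ˡ : ∀ n c (f : ℕ → ℕ) → c * sumBelow f n ≡ sumBelow (λ ℓ → c * f ℓ) n
  sumBelow-*ˡ zero c f = *-zeroʳ c
  sumBelow-*ˡ (suc n) c f = trans (*-distribˡ-+ c (f 0) _) (cong (c * f 0 +_) (sumBelow-*ˡ n c (f ∘ suc)))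

  sumBelow-suc : ∀ n (f : ℕ → ℕ) → sumBelow f (suc n) ≡ sumBelow f n + f n
  sumBelow-suc zero f = +-comm (f 0) 0
  sumBelow-suc (suc n) f = trans (cong (f 0 +_) (sumBelow-suc n (f ∘ suc))) (sym (+-assoc (f 0) _ _))

  sum-map-inits : ∀ {a} {A : Set a} (c : List A → ℕ) w →
                  sum (map c (inits w)) ≡ sumBelow (λ ℓ → c (take ℓ w)) (suc (length w))
  sum-map-inits c [] = refl
  sum-map-inits c (x ∷ w) =
    cong (c [] +_) (trans (cong sum (sym (map-∘ (inits w)))) (sum-map-inits (c ∘ (x ∷_)) w))

  sum-allFin-δ : ∀ {n} (b : Fin n) (g : Fin n → ℕ) → (∀ a → ¬ a ≡ b → g a ≡ 0) →
                 sum (map g (allFin n)) ≡ g b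
  sum-allFin-δ b g g0 = trans (cong sum (map-tabulate (λ x → x) g)) (δ b g g0)
    where
    vanishing : ∀ {n} (g : Fin n → ℕ) → (∀ a → g a ≡ 0) → sum (tabulate g) ≡ 0
    vanishing {zero} g g0 = refl
    vanishing {suc n} g g0 = cong₂ _+_ (g0 Fin.zero) (vanishing (g ∘ Fin.suc) (g0 ∘ Fin.suc))
    δ : ∀ {n} (b : Fin n) (g : Fin n → ℕ) → (∀ a → ¬ a ≡ b → g a ≡ 0) → sum (tabulate g) ≡ g b
    δ Fin.zero g g0 =
      trans (cong (g Fin.zero +_) (vanishing (g ∘ Fin.suc) (λ a → g0 (Fin.suc a) (λ ())))) (+-identityʳ _)
    δ (Fin.suc b) g g0 =
      cong₂ _+_ (g0 Fin.zero (λ ())) (δ b (g ∘ Fin.suc) (λ a a≢b → g0 (Fin.suc a) (a≢b ∘ FinP.suc-injective)))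

  module _ {a} {A : Set a} (_≟_ : DecidableEquality A) where

    remove : A → List A → List A
    remove x [] = []
    remove x (y ∷ ys) with x ≟ y
    ... | yes _ = ys
    ... | no _ = y ∷ remove x ys

    length-remove : ∀ {x} ys → x ∈ ys → suc (length (remove x ys)) ≡ length ys
    length-remove {x} (y ∷ ys) x∈ with x ≟ y
    ... | yes _ = refl
    length-remove {x} (y ∷ ys) (here x≡y) | no x≢y = ⊥-elim (x≢y x≡y)
    length-remove {x} (y ∷ ys) (there x∈) | no _ = cong suc (length-remove ys x∈)

    ∈-remove : ∀ {x z} ys → z ∈ ys → ¬ z ≡ x → z ∈ remove x ys
    ∈-remove {x} (y ∷ ys) z∈ z≢x with x ≟ y
    ∈-remove (y ∷ ys) (here z≡y) z≢x | yes x≡y = ⊥-elim (z≢x (trans z≡y (sym x≡y)))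
    ∈-remove (y ∷ ys) (there z∈) z≢x | yes _ = z∈
    ∈-remove (y ∷ ys) (here z≡y) z≢x | no _ = here z≡y
    ∈-remove (y ∷ ys) (there z∈) z≢x | no _ = there (∈-remove ys z∈ z≢x)

    length-≤-distinct : ∀ (xs ys : List A) → AllPairs (λ x y → ¬ x ≡ y) xs →
                        (∀ {z} → z ∈ xs → z ∈ ys) → length xs ≤ length ys
    length-≤-distinct [] ys _ _ = z≤n
    length-≤-distinct (x ∷ xs) ys (x∉xs ∷ distinct) xs⊆ys =
      subst (suc (length xs) ≤_) (length-remove ys (xs⊆ys (here refl)))
        (s≤s (length-≤-distinct xs (remove x ys) distinct
          (λ z∈xs → ∈-remove ys (xs⊆ys (there z∈xs)) (λ z≡x → All.lookup x∉xs z∈xs (sym z≡x)))))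

  module WordSums (q : ℕ) where

    sumWords : ℕ → (Word q → ℕ) → ℕ
    sumWords N f = sum (map (λ v → f (toList v)) (allWords q N))

    sumWords-suc : ∀ N f → sumWords (suc N) f ≡ sum (map (λ a → sumWords N (f ∘ (a ∷_))) (allFin q))
    sumWords-suc N f =
      trans (sum-map-concatMap _ _ (allFin q))
            (sum-map-cong (λ a → cong sum (sym (map-∘ (allWords q N)))) (allFin q))

    sumWords-cong : ∀ N {f g : Word q → ℕ} → (∀ w → length w ≡ N → f w ≡ g w) → sumWords N f ≡ sumWords N g
    sumWords-cong N f≡g = sum-map-cong (λ v → f≡g (toList v) (length-toList v)) (allWords q N)

    sumWords-mono : ∀ N {f g : Word q → ℕ} → (∀ w → length w ≡ N → f w ≤ g w) → sumWords N f ≤ sumWords N g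
    sumWords-mono N f≤g = sum-map-mono (λ v → f≤g (toList v) (length-toList v)) (allWords q N)

    sumWords-+ : ∀ N (f g : Word q → ℕ) → sumWords N (λ w → f w + g w) ≡ sumWords N f + sumWords N g
    sumWords-+ N f g = sum-map-+ _ _ (allWords q N)

    sumWords-*ˡ : ∀ c N (f : Word q → ℕ) → c * sumWords N f ≡ sumWords N (λ w → c * f w)
    sumWords-*ˡ c N f = sum-map-*ˡ c _ (allWords q N)

    sumWords-const : ∀ N c → sumWords N (λ _ → c) ≡ q ^ N * c
    sumWords-const zero c = refl
    sumWords-const (suc N) c = begin
        sumWords (suc N) (λ _ → c)
      ≡⟨ sumWords-suc N (λ _ → c) ⟩
        sum (map (λ _ → sumWords N (λ _ → c)) (allFin q))
      ≡⟨ sum-map-const _ (allFin q) ⟩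
        length (allFin q) * sumWords N (λ _ → c)
      ≡⟨ cong₂ _*_ (length-tabulate {n = q} (λ x → x)) (sumWords-const N c) ⟩
        q * (q ^ N * c)
      ≡⟨ *-assoc q (q ^ N) c ⟨
        q ^ suc N * c ∎
      where open ≡-Reasoning

    sumWords-zero : ∀ N → sumWords N (λ _ → 0) ≡ 0
    sumWords-zero N = trans (sumWords-const N 0) (*-zeroʳ (q ^ N))

    sumWords-pos : ∀ N (f : Word q → ℕ) → 0 < sumWords N f → Σ (Word q) (λ w → length w ≡ N × 0 < f w)
    sumWords-pos N f pos with sum-map-pos _ (allWords q N) pos
    ... | v , fv>0 = toList v , length-toList v , fv>0

    sumWords-sumBelow : ∀ N (g : ℕ → Word q → ℕ) n →
      sumWords N (λ w → sumBelow (λ ℓ → g ℓ w) n) ≡ sumBelow (λ ℓ → sumWords N (g ℓ)) n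
    sumWords-sumBelow N g zero = sumWords-zero N
    sumWords-sumBelow N g (suc n) =
      trans (sumWords-+ N (g 0) (λ w → sumBelow (λ ℓ → g (suc ℓ) w) n))
            (cong (sumWords N (g 0) +_) (sumWords-sumBelow N (g ∘ suc) n))

    sumWords-swap : ∀ N M (g : Word q → Word q → ℕ) →
      sumWords N (λ w → sumWords M (g w)) ≡ sumWords M (λ v → sumWords N (λ w → g w v))
    sumWords-swap N M g = sum-map-swap (λ x y → g (toList x) (toList y)) (allWords q N) (allWords q M)

    sumWords-δ : ∀ N (w₀ : Word q) → length w₀ ≡ N → sumWords N (λ w → 𝟙 (w ≟w w₀)) ≡ 1
    sumWords-δ zero [] refl = refl
    sumWords-δ (suc N) (b ∷ w₀) |w₀|+1≡N = begin
        sumWords (suc N) (λ w → 𝟙 (w ≟w (b ∷ w₀)))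
      ≡⟨ sumWords-suc N (λ w → 𝟙 (w ≟w (b ∷ w₀))) ⟩
        sum (map g (allFin q))
      ≡⟨ sum-allFin-δ b g g-off-b ⟩
        g b
      ≡⟨ sumWords-cong N (λ w _ → 𝟙-cong ∷-injectiveʳ (cong (b ∷_)) ((b ∷ w) ≟w (b ∷ w₀)) (w ≟w w₀)) ⟩
        sumWords N (λ w → 𝟙 (w ≟w w₀))
      ≡⟨ sumWords-δ N w₀ (suc-injective |w₀|+1≡N) ⟩
        1 ∎
      where
      open ≡-Reasoning
      g : Fin q → ℕ
      g a = sumWords N (λ w → 𝟙 ((a ∷ w) ≟w (b ∷ w₀)))
      g-off-b : ∀ a → ¬ a ≡ b → g a ≡ 0
      g-off-b a a≢b =
        trans (sumWords-cong N (λ w _ → 𝟙-false (a≢b ∘ ∷-injectiveˡ) ((a ∷ w) ≟w (b ∷ w₀)))) (sumWords-zero N)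

    sumWords-atMostOne : ∀ N {s} {S : Word q → Set s} (S? : Decidable S) →
      (∀ w w' → length w ≡ N → length w' ≡ N → S w → S w' → w ≡ w') →
      sumWords N (λ w → 𝟙 (S? w)) ≤ 1
    sumWords-atMostOne N S? unique with sumWords N (λ w → 𝟙 (S? w)) in eq
    ... | zero = z≤n
    ... | suc n with sumWords-pos N _ (subst (0 <_) (sym eq) (s≤s z≤n))
    ...   | w₀ , |w₀|≡N , Sw₀ = subst (_≤ 1) eq (begin
        sumWords N (λ w → 𝟙 (S? w))
      ≤⟨ sumWords-mono N below-δ ⟩
        sumWords N (λ w → 𝟙 (w ≟w w₀))
      ≡⟨ sumWords-δ N w₀ |w₀|≡N ⟩
        1 ∎)
      where
      open ≤-Reasoning
      below-δ : ∀ w → length w ≡ N → 𝟙 (S? w) ≤ 𝟙 (w ≟w w₀)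
      below-δ w |w|≡N with S? w
      ... | no _ = z≤n
      ... | yes Sw = ≤-reflexive (sym (𝟙-true (unique w w₀ |w|≡N |w₀|≡N Sw (𝟙-witness (S? w₀) Sw₀)) _))

    sumWords-injection : ∀ N M {s} {Q : Word q → Set s} (Q? : Decidable Q) (f : Word q → Word q) →
      (∀ w → length w ≡ N → length (f w) ≡ M) →
      (∀ w w' → length w ≡ N → length w' ≡ N → Q w → Q w' → f w ≡ f w' → w ≡ w') →
      sumWords N (λ w → 𝟙 (Q? w)) ≤ q ^ M
    sumWords-injection N M Q? f |f| f-inj = begin
        sumWords N (λ w → 𝟙 (Q? w))
      ≡⟨ sumWords-cong N (λ w _ → *-identityʳ (𝟙 (Q? w))) ⟨
        sumWords N (λ w → 𝟙 (Q? w) * 1)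
      ≡⟨ sumWords-cong N (λ w |w| → cong (𝟙 (Q? w) *_) (sumWords-δ M (f w) (|f| w |w|))) ⟨
        sumWords N (λ w → 𝟙 (Q? w) * sumWords M (λ v → 𝟙 (v ≟w f w)))
      ≡⟨ sumWords-cong N (λ w _ → sumWords-*ˡ (𝟙 (Q? w)) M (λ v → 𝟙 (v ≟w f w))) ⟩
        sumWords N (λ w → sumWords M (λ v → 𝟙 (Q? w) * 𝟙 (v ≟w f w)))
      ≡⟨ sumWords-swap N M (λ w v → 𝟙 (Q? w) * 𝟙 (v ≟w f w)) ⟩
        sumWords M (λ v → sumWords N (λ w → 𝟙 (Q? w) * 𝟙 (v ≟w f w)))
      ≤⟨ sumWords-mono M (λ v _ → fibre≤1 v) ⟩
        sumWords M (λ _ → 1)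
      ≡⟨ sumWords-const M 1 ⟩
        q ^ M * 1
      ≡⟨ *-identityʳ _ ⟩
        q ^ M ∎
      where
      open ≤-Reasoning
      fibre≤1 : ∀ v → sumWords N (λ w → 𝟙 (Q? w) * 𝟙 (v ≟w f w)) ≤ 1
      fibre≤1 v = ≤-trans (≤-reflexive (sumWords-cong N (λ w _ → 𝟙-× (Q? w) (v ≟w f w))))
        (sumWords-atMostOne N (λ w → Q? w ×-dec (v ≟w f w))
          (λ w w' |w| |w'| (Qw , v≡fw) (Qw' , v≡fw') → f-inj w w' |w| |w'| Qw Qw' (trans (sym v≡fw) v≡fw')))

  -- Palindromic prefixes are determined by their second half.
  module _ {a} {A : Set a} where

    take-++ˡ : ∀ k (xs ys : List A) → k ≤ length xs → take k (xs ++ ys) ≡ take k xs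
    take-++ˡ zero xs ys _ = refl
    take-++ˡ (suc k) (x ∷ xs) ys (s≤s k≤|xs|) = cong (x ∷_) (take-++ˡ k xs ys k≤|xs|)

    palindrome-mirror : ∀ k j (w : List A) → k ≤ j → k + j ≤ length w →
      take (k + j) w ≡ reverse (take (k + j) w) →
      take k w ≡ take k (reverse (take j (drop k w)))
    palindrome-mirror k j w k≤j k+j≤|w| pal = begin
        take k w
      ≡⟨ cong (λ n → take n w) (m≤n⇒m⊓n≡m (m≤m+n k j)) ⟨
        take (k ⊓ (k + j)) w
      ≡⟨ take-take k (k + j) w ⟨
        take k p
      ≡⟨ cong (take k) pal ⟩
        take k (reverse p)
      ≡⟨ cong (take k ∘ reverse) (take++drop≡id k p) ⟨
        take k (reverse (take k p ++ drop k p))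
      ≡⟨ cong (take k) (reverse-++ (take k p) (drop k p)) ⟩
        take k (reverse (drop k p) ++ reverse (take k p))
      ≡⟨ cong (λ s → take k (reverse s ++ reverse (take k p))) (take-drop j k w) ⟨
        take k (reverse s ++ reverse (take k p))
      ≡⟨ take-++ˡ k (reverse s) (reverse (take k p)) k≤|reverse-s| ⟩
        take k (reverse s) ∎
      where
      open ≡-Reasoning
      p = take (k + j) w
      s = take j (drop k w)
      |s|≡j : length s ≡ j
      |s|≡j = begin
          length s                 ≡⟨ length-take j (drop k w) ⟩
          j ⊓ length (drop k w)    ≡⟨ cong (j ⊓_) (length-drop k w) ⟩
          j ⊓ (length w ∸ k)       ≡⟨ m≤n⇒m⊓n≡m (subst (_≤ length w ∸ k) (m+n∸m≡n k j) (∸-monoˡ-≤ k k+j≤|w|)) ⟩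
          j                        ∎
      k≤|reverse-s| : k ≤ length (reverse s)
      k≤|reverse-s| = subst (k ≤_) (sym (trans (length-reverse s) |s|≡j)) k≤j

    palindrome-prefix-injective : ∀ k j (w w' : List A) → k ≤ j →
      k + j ≤ length w → k + j ≤ length w' →
      take (k + j) w ≡ reverse (take (k + j) w) → take (k + j) w' ≡ reverse (take (k + j) w') →
      drop k w ≡ drop k w' → w ≡ w'
    palindrome-prefix-injective k j w w' k≤j k+j≤|w| k+j≤|w'| pal pal' same-tail = begin
        w                                                  ≡⟨ take++drop≡id k w ⟨
        take k w ++ drop k w                               ≡⟨ cong (_++ drop k w) (palindrome-mirror k j w k≤j k+j≤|w| pal) ⟩
        take k (reverse (take j (drop k w))) ++ drop k w   ≡⟨ cong (λ t → take k (reverse (take j t)) ++ t) same-tail ⟩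
        take k (reverse (take j (drop k w'))) ++ drop k w' ≡⟨ cong (_++ drop k w') (palindrome-mirror k j w' k≤j k+j≤|w'| pal') ⟨
        take k w' ++ drop k w'                             ≡⟨ take++drop≡id k w' ⟩
        w'                                                 ∎
      where open ≡-Reasoning

  -- Palindromes of length at least 2; the remaining nonempty palindromes are the q letters.
  IsLongPalindrome : ∀ {q} → Word q → Set
  IsLongPalindrome [] = ⊥
  IsLongPalindrome (_ ∷ []) = ⊥
  IsLongPalindrome w@(_ ∷ _ ∷ _) = IsPalindrome w

  isLongPalindrome? : ∀ {q} → Decidable (IsLongPalindrome {q})
  isLongPalindrome? [] = no (λ ())
  isLongPalindrome? (_ ∷ []) = no (λ ())
  isLongPalindrome? w@(_ ∷ _ ∷ _) = isPalindrome? w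

  longPalindrome⇒palindrome : ∀ {q} (w : Word q) → IsLongPalindrome w → IsPalindrome w
  longPalindrome⇒palindrome (_ ∷ _ ∷ _) pal = pal

  longPalPrefixes : ∀ {q} → Word q → ℕ
  longPalPrefixes w = length (filter isLongPalindrome? (inits w))

  longPalOccurrences : ∀ {q} → Word q → ℕ
  longPalOccurrences w = length (filter isLongPalindrome? (concatMap inits (tails w)))

  longPalOccurrences-∷ : ∀ {q} (a : Fin q) w →
    longPalOccurrences (a ∷ w) ≡ longPalPrefixes (a ∷ w) + longPalOccurrences w
  longPalOccurrences-∷ a w =
    trans (cong length (filter-++ isLongPalindrome? (inits (a ∷ w)) (concatMap inits (tails w))))
          (length-++ (filter isLongPalindrome? (inits (a ∷ w))))

  -- Each distinct palindromic factor is a letter or a long palindrome occurring somewhere,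
  -- so P(w) ≤ q + (number of occurrences of long palindromes).
  P-≤ : ∀ {q} (w : Word q) → P w ≤ q + longPalOccurrences w
  P-≤ {q} w = begin
      length distinctPals
    ≤⟨ length-≤-distinct _≟w_ distinctPals (letters ++ longPals) (deduplicate-! _≟w_ _) classify ⟩
      length (letters ++ longPals)
    ≡⟨ length-++ letters ⟩
      length letters + length longPals
    ≡⟨ cong (_+ length longPals) (trans (length-map _ (allFin q)) (length-tabulate {n = q} (λ x → x))) ⟩
      q + longPalOccurrences w ∎
    where
    open ≤-Reasoning
    distinctPals = deduplicate _≟w_ (filter isPalindrome? (factors w))
    letters = map (λ a → a ∷ []) (allFin q)
    longPals = filter isLongPalindrome? (concatMap inits (tails w))
    classify : ∀ {u} → u ∈ distinctPals → u ∈ letters ++ longPals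
    classify {u} u∈ with ∈-filter⁻ isPalindrome? {xs = factors w} (∈-deduplicate⁻ _≟w_ _ u∈)
    ... | u∈factors , pal with ∈-filter⁻ nonEmpty? {xs = concatMap inits (tails w)} u∈factors
    ...   | u∈blocks , nonempty with u
    ...     | [] = ⊥-elim (nonempty refl)
    ...     | a ∷ [] = ∈-++⁺ˡ (∈-map⁺ (λ a → a ∷ []) (∈-allFin a))
    ...     | _ ∷ _ ∷ _ = ∈-++⁺ʳ letters (∈-filter⁺ isLongPalindrome? u∈blocks pal)

  module Averages (q : ℕ) where
    open WordSums q

    -- At most q^(N - ⌊ℓ/2⌋) words of length N begin with a palindrome of length ℓ ≤ N,
    -- since the first ⌊ℓ/2⌋ letters are determined by the others.
    palindromic-prefix-count : ∀ N ℓ → ℓ ≤ N →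
      sumWords N (λ w → 𝟙 (isPalindrome? (take ℓ w))) ≤ q ^ (N ∸ ⌊ ℓ /2⌋)
    palindromic-prefix-count N ℓ ℓ≤N =
      subst (λ n → sumWords N (λ w → 𝟙 (isPalindrome? (take n w))) ≤ q ^ (N ∸ k)) (⌊n/2⌋+⌈n/2⌉≡n ℓ)
        (sumWords-injection N (N ∸ k) (λ w → isPalindrome? (take (k + j) w)) (drop k)
          (λ w |w| → trans (length-drop k w) (cong (_∸ k) |w|))
          (λ w w' |w| |w'| → palindrome-prefix-injective k j w w' (⌊n/2⌋≤⌈n/2⌉ ℓ) (k+j≤ {w} |w|) (k+j≤ {w'} |w'|)))
      where
      k = ⌊ ℓ /2⌋
      j = ⌈ ℓ /2⌉
      k+j≤ : ∀ {w : Word q} → length w ≡ N → k + j ≤ length w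
      k+j≤ |w| = subst₂ _≤_ (sym (⌊n/2⌋+⌈n/2⌉≡n ℓ)) (sym |w|) ℓ≤N

    prefixBound : ℕ → ℕ → ℕ
    prefixBound N 0 = 0
    prefixBound N 1 = 0
    prefixBound N ℓ@(suc (suc _)) = q ^ (N ∸ ⌊ ℓ /2⌋)

    long-palindromic-prefix-count : ∀ N ℓ → ℓ ≤ N →
      sumWords N (λ w → 𝟙 (isLongPalindrome? (take ℓ w))) ≤ prefixBound N ℓ
    long-palindromic-prefix-count N 0 _ = ≤-reflexive (sumWords-zero N)
    long-palindromic-prefix-count N 1 _ = ≤-reflexive (trans (sumWords-cong N single-letter) (sumWords-zero N))
      where
      single-letter : ∀ (w : Word q) → length w ≡ N → 𝟙 (isLongPalindrome? (take 1 w)) ≡ 0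
      single-letter [] _ = refl
      single-letter (_ ∷ _) _ = refl
    long-palindromic-prefix-count N ℓ@(suc (suc _)) ℓ≤N =
      ≤-trans (sumWords-mono N (λ w _ → long≤pal (take ℓ w))) (palindromic-prefix-count N ℓ ℓ≤N)
      where
      long≤pal : ∀ u → 𝟙 (isLongPalindrome? u) ≤ 𝟙 (isPalindrome? u)
      long≤pal u = 𝟙-mono (longPalindrome⇒palindrome u) (isLongPalindrome? u) (isPalindrome? u)

    prefixSumBound : ℕ → ℕ
    prefixSumBound N = sumBelow (prefixBound N) (suc N)

    longPalPrefixes-sum : ∀ N → sumWords N longPalPrefixes ≤ prefixSumBound N
    longPalPrefixes-sum N = begin
        sumWords N longPalPrefixes
      ≡⟨ sumWords-cong N as-range-sum ⟩
        sumWords N (λ w → sumBelow (λ ℓ → 𝟙 (isLongPalindrome? (take ℓ w))) (suc N))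
      ≡⟨ sumWords-sumBelow N (λ ℓ w → 𝟙 (isLongPalindrome? (take ℓ w))) (suc N) ⟩
        sumBelow (λ ℓ → sumWords N (λ w → 𝟙 (isLongPalindrome? (take ℓ w)))) (suc N)
      ≤⟨ sumBelow-mono (suc N) (λ ℓ ℓ<1+N → long-palindromic-prefix-count N ℓ (≤-pred ℓ<1+N)) ⟩
        prefixSumBound N ∎
      where
      open ≤-Reasoning
      as-range-sum : ∀ w → length w ≡ N →
        longPalPrefixes w ≡ sumBelow (λ ℓ → 𝟙 (isLongPalindrome? (take ℓ w))) (suc N)
      as-range-sum w refl =
        trans (length-filter-𝟙 isLongPalindrome? (inits w)) (sum-map-inits (λ u → 𝟙 (isLongPalindrome? u)) w)

    occurrenceBound : ℕ → ℕ
    occurrenceBound zero = 0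
    occurrenceBound (suc N) = q * occurrenceBound N + prefixSumBound (suc N)

    longPalOccurrences-sum : ∀ N → sumWords N longPalOccurrences ≤ occurrenceBound N
    longPalOccurrences-sum zero = ≤-refl
    longPalOccurrences-sum (suc N) = begin
        sumWords (suc N) longPalOccurrences
      ≡⟨ sumWords-suc N longPalOccurrences ⟩
        sum (map (λ a → sumWords N (longPalOccurrences ∘ (a ∷_))) (allFin q))
      ≡⟨ sum-map-cong split (allFin q) ⟩
        sum (map (λ a → sumWords N (longPalPrefixes ∘ (a ∷_)) + sumWords N longPalOccurrences) (allFin q))
      ≡⟨ sum-map-+ _ (λ _ → sumWords N longPalOccurrences) (allFin q) ⟩
        sum (map (λ a → sumWords N (longPalPrefixes ∘ (a ∷_))) (allFin q))
          + sum (map (λ _ → sumWords N longPalOccurrences) (allFin q))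
      ≡⟨ cong₂ _+_ (sym (sumWords-suc N longPalPrefixes)) (sum-map-const (sumWords N longPalOccurrences) (allFin q)) ⟩
        sumWords (suc N) longPalPrefixes + length (allFin q) * sumWords N longPalOccurrences
      ≡⟨ cong (λ n → sumWords (suc N) longPalPrefixes + n * sumWords N longPalOccurrences) (length-tabulate {n = q} (λ x → x)) ⟩
        sumWords (suc N) longPalPrefixes + q * sumWords N longPalOccurrences
      ≤⟨ +-mono-≤ (longPalPrefixes-sum (suc N)) (*-monoʳ-≤ q (longPalOccurrences-sum N)) ⟩
        prefixSumBound (suc N) + q * occurrenceBound N
      ≡⟨ +-comm (prefixSumBound (suc N)) _ ⟩
        occurrenceBound (suc N) ∎
      where
      open ≤-Reasoning
      split : ∀ a → sumWords N (longPalOccurrences ∘ (a ∷_))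
                  ≡ sumWords N (longPalPrefixes ∘ (a ∷_)) + sumWords N longPalOccurrences
      split a = trans (sumWords-cong N (λ w _ → longPalOccurrences-∷ a w))
                      (sumWords-+ N (longPalPrefixes ∘ (a ∷_)) longPalOccurrences)

    totalP-≤ : ∀ N → totalP q N ≤ q ^ N * q + occurrenceBound N
    totalP-≤ N = begin
        sumWords N P
      ≤⟨ sumWords-mono N (λ w _ → P-≤ w) ⟩
        sumWords N (λ w → q + longPalOccurrences w)
      ≡⟨ sumWords-+ N (λ _ → q) longPalOccurrences ⟩
        sumWords N (λ _ → q) + sumWords N longPalOccurrences
      ≤⟨ +-mono-≤ (≤-reflexive (sumWords-const N q)) (longPalOccurrences-sum N) ⟩
        q ^ N * q + occurrenceBound N ∎
      where open ≤-Reasoning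

    prefixBound-suc : ∀ N ℓ → ℓ ≤ N → prefixBound (suc N) ℓ ≡ q * prefixBound N ℓ
    prefixBound-suc N 0 _ = sym (*-zeroʳ q)
    prefixBound-suc N 1 _ = sym (*-zeroʳ q)
    prefixBound-suc N ℓ@(suc (suc _)) ℓ≤N = cong (q ^_) (+-∸-assoc 1 (≤-trans (⌊n/2⌋≤n ℓ) ℓ≤N))

    prefixSumBound-suc : ∀ N → prefixSumBound (suc N) ≡ q * prefixSumBound N + prefixBound (suc N) (suc N)
    prefixSumBound-suc N = begin
        sumBelow (prefixBound (suc N)) (suc (suc N))
      ≡⟨ sumBelow-suc (suc N) (prefixBound (suc N)) ⟩
        sumBelow (prefixBound (suc N)) (suc N) + prefixBound (suc N) (suc N)
      ≡⟨ cong (_+ prefixBound (suc N) (suc N)) (sumBelow-cong (suc N) (λ ℓ ℓ<1+N → prefixBound-suc N ℓ (≤-pred ℓ<1+N))) ⟩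
        sumBelow (λ ℓ → q * prefixBound N ℓ) (suc N) + prefixBound (suc N) (suc N)
      ≡⟨ cong (_+ prefixBound (suc N) (suc N)) (sumBelow-*ˡ (suc N) q (prefixBound N)) ⟨
        q * prefixSumBound N + prefixBound (suc N) (suc N) ∎
      where open ≡-Reasoning

    prefixBound-diagonal : ∀ n → prefixBound (2 + n) (2 + n) ≡ q ^ suc ⌈ n /2⌉
    prefixBound-diagonal n = cong (q ^_) (trans (+-∸-assoc 1 (⌊n/2⌋≤n n)) (cong suc n∸⌊n/2⌋≡⌈n/2⌉))
      where
      n∸⌊n/2⌋≡⌈n/2⌉ : n ∸ ⌊ n /2⌋ ≡ ⌈ n /2⌉
      n∸⌊n/2⌋≡⌈n/2⌉ = trans (cong (_∸ ⌊ n /2⌋) (sym (⌊n/2⌋+⌈n/2⌉≡n n))) (m+n∸m≡n ⌊ n /2⌋ ⌈ n /2⌉)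

-- Closed forms of the bounds, with the denominators q - 1 cleared; the algebra is done in ℤ.
module ClosedForms (q : ℕ) where

  open import Data.Nat as ℕ using (ℕ; zero; suc; ⌊_/2⌋; ⌈_/2⌉)
  open import Data.Nat.Properties using (*-suc; ^-distribˡ-+-*; +-identityʳ; n≡⌊n+n/2⌋; n≡⌈n+n/2⌉)
  open import Data.Integer using (ℤ; +_; _+_; _*_; _-_)
  open import Data.Integer.Properties using (pos-+; pos-*)
  open import Data.Integer.Tactic.RingSolver using (solve-∀)
  open import Relation.Binary.PropositionalEquality
  open Counting.Averages q using (prefixBound; prefixSumBound; occurrenceBound; prefixSumBound-suc; prefixBound-diagonal)

  ⌊2*m/2⌋≡m : ∀ m → ⌊ 2 ℕ.* m /2⌋ ≡ m
  ⌊2*m/2⌋≡m m = sym (trans (n≡⌊n+n/2⌋ m) (cong (λ n → ⌊ m ℕ.+ n /2⌋) (sym (+-identityʳ m))))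

  ⌈2*m/2⌉≡m : ∀ m → ⌈ 2 ℕ.* m /2⌉ ≡ m
  ⌈2*m/2⌉≡m m = sym (trans (n≡⌈n+n/2⌉ m) (cong (λ n → ⌈ m ℕ.+ n /2⌉) (sym (+-identityʳ m))))

  Q : ℤ
  Q = + q

  x : ℕ → ℤ
  x m = + (q ℕ.^ m)

  x-suc : ∀ m → x (suc m) ≡ Q * x m
  x-suc m = pos-* q (q ℕ.^ m)

  cast-affine : ∀ a b → + (q ℕ.* a ℕ.+ b) ≡ Q * + a + + b
  cast-affine a b = trans (pos-+ (q ℕ.* a) b) (cong (_+ + b) (pos-* q a))

  prefixSum-step : ∀ N → (Q - + 1) * + prefixSumBound (suc N)
                       ≡ Q * ((Q - + 1) * + prefixSumBound N) + (Q - + 1) * + prefixBound (suc N) (suc N)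
  prefixSum-step N =
    trans (cong (λ n → (Q - + 1) * + n) (prefixSumBound-suc N))
          (trans (cong ((Q - + 1) *_) (cast-affine _ _)) (distribute Q (Q - + 1) _ _))
    where
    distribute : ∀ Q d r t → d * (Q * r + t) ≡ Q * (d * r) + d * t
    distribute = solve-∀

  occurrence-step : ∀ N → (Q - + 1) * (Q - + 1) * + occurrenceBound (suc N)
    ≡ Q * ((Q - + 1) * (Q - + 1) * + occurrenceBound N) + (Q - + 1) * ((Q - + 1) * + prefixSumBound (suc N))
  occurrence-step N = trans (cong ((Q - + 1) * (Q - + 1) *_) (cast-affine _ _)) (distribute Q (Q - + 1) _ _)
    where
    distribute : ∀ Q d t r → d * d * (Q * t + r) ≡ Q * (d * d * t) + d * (d * r)
    distribute = solve-∀

  diagonal-even : ∀ m → + prefixBound (2 ℕ.+ 2 ℕ.* m) (2 ℕ.+ 2 ℕ.* m) ≡ Q * x m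
  diagonal-even m =
    trans (cong +_ (trans (prefixBound-diagonal (2 ℕ.* m)) (cong (λ e → q ℕ.^ suc e) (⌈2*m/2⌉≡m m)))) (x-suc m)

  diagonal-odd : ∀ m → + prefixBound (3 ℕ.+ 2 ℕ.* m) (3 ℕ.+ 2 ℕ.* m) ≡ Q * (Q * x m)
  diagonal-odd m =
    trans (cong +_ (trans (prefixBound-diagonal (1 ℕ.+ 2 ℕ.* m)) (cong (λ e → q ℕ.^ suc (suc e)) (⌊2*m/2⌋≡m m))))
          (trans (x-suc (suc m)) (cong (Q *_) (x-suc m)))

  prefixSum-odd : ∀ m → (Q - + 1) * + prefixSumBound (1 ℕ.+ 2 ℕ.* m) ≡ + 2 * Q * x m * x m - + 2 * Q * x m
  prefixSum-even : ∀ m → (Q - + 1) * + prefixSumBound (2 ℕ.+ 2 ℕ.* m) ≡ + 2 * Q * Q * x m * x m - Q * Q * x m - Q * x m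

  prefixSum-odd zero = base Q
    where
    base : ∀ Q → (Q - + 1) * + 0 ≡ + 2 * Q * + 1 * + 1 - + 2 * Q * + 1
    base = solve-∀
  prefixSum-odd (suc m) = begin
      (Q - + 1) * + prefixSumBound (1 ℕ.+ 2 ℕ.* suc m)
    ≡⟨ cong (λ n → (Q - + 1) * + prefixSumBound (1 ℕ.+ n)) (*-suc 2 m) ⟩
      (Q - + 1) * + prefixSumBound (3 ℕ.+ 2 ℕ.* m)
    ≡⟨ prefixSum-step (2 ℕ.+ 2 ℕ.* m) ⟩
      Q * ((Q - + 1) * + prefixSumBound (2 ℕ.+ 2 ℕ.* m)) + (Q - + 1) * + prefixBound (3 ℕ.+ 2 ℕ.* m) (3 ℕ.+ 2 ℕ.* m)
    ≡⟨ cong₂ (λ r t → Q * r + (Q - + 1) * t) (prefixSum-even m) (diagonal-odd m) ⟩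
      Q * (+ 2 * Q * Q * x m * x m - Q * Q * x m - Q * x m) + (Q - + 1) * (Q * (Q * x m))
    ≡⟨ step Q (x m) ⟩
      + 2 * Q * (Q * x m) * (Q * x m) - + 2 * Q * (Q * x m)
    ≡⟨ cong (λ y → + 2 * Q * y * y - + 2 * Q * y) (x-suc m) ⟨
      + 2 * Q * x (suc m) * x (suc m) - + 2 * Q * x (suc m) ∎
    where
    open ≡-Reasoning
    step : ∀ Q x → Q * (+ 2 * Q * Q * x * x - Q * Q * x - Q * x) + (Q - + 1) * (Q * (Q * x))
                 ≡ + 2 * Q * (Q * x) * (Q * x) - + 2 * Q * (Q * x)
    step = solve-∀

  prefixSum-even m = begin
      (Q - + 1) * + prefixSumBound (2 ℕ.+ 2 ℕ.* m)
    ≡⟨ prefixSum-step (1 ℕ.+ 2 ℕ.* m) ⟩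
      Q * ((Q - + 1) * + prefixSumBound (1 ℕ.+ 2 ℕ.* m)) + (Q - + 1) * + prefixBound (2 ℕ.+ 2 ℕ.* m) (2 ℕ.+ 2 ℕ.* m)
    ≡⟨ cong₂ (λ r t → Q * r + (Q - + 1) * t) (prefixSum-odd m) (diagonal-even m) ⟩
      Q * (+ 2 * Q * x m * x m - + 2 * Q * x m) + (Q - + 1) * (Q * x m)
    ≡⟨ step Q (x m) ⟩
      + 2 * Q * Q * x m * x m - Q * Q * x m - Q * x m ∎
    where
    open ≡-Reasoning
    step : ∀ Q x → Q * (+ 2 * Q * x * x - + 2 * Q * x) + (Q - + 1) * (Q * x)
                 ≡ + 2 * Q * Q * x * x - Q * Q * x - Q * x
    step = solve-∀

  occurrence-even : ∀ m → (Q - + 1) * (Q - + 1) * + occurrenceBound (2 ℕ.* m)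
    ≡ (+ 3 * Q + + 1) * x m + + 4 * + m * (Q - + 1) * x m * x m - (+ 3 * Q + + 1) * x m * x m
  occurrence-odd : ∀ m → (Q - + 1) * (Q - + 1) * + occurrenceBound (1 ℕ.+ 2 ℕ.* m)
    ≡ Q * (Q + + 3) * x m + + 2 * (+ 1 + + 2 * + m) * (Q - + 1) * Q * x m * x m - (+ 3 * Q + + 1) * Q * x m * x m

  occurrence-even zero = base Q
    where
    base : ∀ Q → (Q - + 1) * (Q - + 1) * + 0
               ≡ (+ 3 * Q + + 1) * + 1 + + 4 * + 0 * (Q - + 1) * + 1 * + 1 - (+ 3 * Q + + 1) * + 1 * + 1
    base = solve-∀
  occurrence-even (suc m) = begin
      (Q - + 1) * (Q - + 1) * + occurrenceBound (2 ℕ.* suc m)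
    ≡⟨ cong (λ n → (Q - + 1) * (Q - + 1) * + occurrenceBound n) (*-suc 2 m) ⟩
      (Q - + 1) * (Q - + 1) * + occurrenceBound (2 ℕ.+ 2 ℕ.* m)
    ≡⟨ occurrence-step (1 ℕ.+ 2 ℕ.* m) ⟩
      Q * ((Q - + 1) * (Q - + 1) * + occurrenceBound (1 ℕ.+ 2 ℕ.* m))
        + (Q - + 1) * ((Q - + 1) * + prefixSumBound (2 ℕ.+ 2 ℕ.* m))
    ≡⟨ cong₂ (λ t r → Q * t + (Q - + 1) * r) (occurrence-odd m) (prefixSum-even m) ⟩
      Q * (Q * (Q + + 3) * x m + + 2 * (+ 1 + + 2 * + m) * (Q - + 1) * Q * x m * x m - (+ 3 * Q + + 1) * Q * x m * x m)
        + (Q - + 1) * (+ 2 * Q * Q * x m * x m - Q * Q * x m - Q * x m)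
    ≡⟨ step Q (x m) (+ m) ⟩
      (+ 3 * Q + + 1) * (Q * x m) + + 4 * (+ 1 + + m) * (Q - + 1) * (Q * x m) * (Q * x m)
        - (+ 3 * Q + + 1) * (Q * x m) * (Q * x m)
    ≡⟨ cong₂ (λ n y → (+ 3 * Q + + 1) * y + + 4 * n * (Q - + 1) * y * y - (+ 3 * Q + + 1) * y * y)
             (pos-+ 1 m) (x-suc m) ⟨
      (+ 3 * Q + + 1) * x (suc m) + + 4 * + suc m * (Q - + 1) * x (suc m) * x (suc m)
        - (+ 3 * Q + + 1) * x (suc m) * x (suc m) ∎
    where
    open ≡-Reasoning
    step : ∀ Q x m →
      Q * (Q * (Q + + 3) * x + + 2 * (+ 1 + + 2 * m) * (Q - + 1) * Q * x * x - (+ 3 * Q + + 1) * Q * x * x)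
        + (Q - + 1) * (+ 2 * Q * Q * x * x - Q * Q * x - Q * x)
      ≡ (+ 3 * Q + + 1) * (Q * x) + + 4 * (+ 1 + m) * (Q - + 1) * (Q * x) * (Q * x) - (+ 3 * Q + + 1) * (Q * x) * (Q * x)
    step = solve-∀

  occurrence-odd m = begin
      (Q - + 1) * (Q - + 1) * + occurrenceBound (1 ℕ.+ 2 ℕ.* m)
    ≡⟨ occurrence-step (2 ℕ.* m) ⟩
      Q * ((Q - + 1) * (Q - + 1) * + occurrenceBound (2 ℕ.* m)) + (Q - + 1) * ((Q - + 1) * + prefixSumBound (1 ℕ.+ 2 ℕ.* m))
    ≡⟨ cong₂ (λ t r → Q * t + (Q - + 1) * r) (occurrence-even m) (prefixSum-odd m) ⟩
      Q * ((+ 3 * Q + + 1) * x m + + 4 * + m * (Q - + 1) * x m * x m - (+ 3 * Q + + 1) * x m * x m)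
        + (Q - + 1) * (+ 2 * Q * x m * x m - + 2 * Q * x m)
    ≡⟨ step Q (x m) (+ m) ⟩
      Q * (Q + + 3) * x m + + 2 * (+ 1 + + 2 * + m) * (Q - + 1) * Q * x m * x m - (+ 3 * Q + + 1) * Q * x m * x m ∎
    where
    open ≡-Reasoning
    step : ∀ Q x m →
      Q * ((+ 3 * Q + + 1) * x + + 4 * m * (Q - + 1) * x * x - (+ 3 * Q + + 1) * x * x)
        + (Q - + 1) * (+ 2 * Q * x * x - + 2 * Q * x)
      ≡ Q * (Q + + 3) * x + + 2 * (+ 1 + + 2 * m) * (Q - + 1) * Q * x * x - (+ 3 * Q + + 1) * Q * x * x
    step = solve-∀

  x-double : ∀ m → + (q ℕ.^ (2 ℕ.* m)) ≡ x m * x m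
  x-double m = trans (cong +_ (trans (^-distribˡ-+-* q m (m ℕ.+ 0)) (cong (λ e → q ℕ.^ m ℕ.* q ℕ.^ e) (+-identityʳ m))))
                     (pos-* (q ℕ.^ m) (q ℕ.^ m))

  -- The bound q^N · q + occurrenceBound N on q^N · M_q(N), brought to the common denominator
  -- q^⌊N/2⌋ (q - 1)² of the theorem.
  totalBound-odd : ∀ m → let N = 1 ℕ.+ 2 ℕ.* m in
    + (q ℕ.^ N ℕ.* q ℕ.+ occurrenceBound N) * (x m * ((Q - + 1) * (Q - + 1)))
      ≡ (+ (q ℕ.+ 3) + linPart q N * x m) * + (q ℕ.^ N)
  totalBound-odd m = begin
      + (q ℕ.^ N ℕ.* q ℕ.+ occurrenceBound N) * (x m * ((Q - + 1) * (Q - + 1)))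
    ≡⟨ cong (_* (x m * ((Q - + 1) * (Q - + 1)))) cast ⟩
      (Q * (x m * x m) * Q + + occurrenceBound N) * (x m * ((Q - + 1) * (Q - + 1)))
    ≡⟨ expand Q (x m) _ ⟩
      x m * (Q * (x m * x m) * Q * (Q - + 1) * (Q - + 1)) + x m * ((Q - + 1) * (Q - + 1) * + occurrenceBound N)
    ≡⟨ cong (λ c → x m * (Q * (x m * x m) * Q * (Q - + 1) * (Q - + 1)) + x m * c) (occurrence-odd m) ⟩
      x m * (Q * (x m * x m) * Q * (Q - + 1) * (Q - + 1))
        + x m * (Q * (Q + + 3) * x m + + 2 * (+ 1 + + 2 * + m) * (Q - + 1) * Q * x m * x m - (+ 3 * Q + + 1) * Q * x m * x m)
    ≡⟨ collect Q (x m) (+ m) ⟩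
      (Q + + 3 + (+ 2 * (+ 1 + + 2 * + m) * (Q - + 1) + Q * (Q * (Q * + 1)) - + 2 * (Q * (Q * + 1)) - + 2 * Q - + 1) * x m)
        * (Q * (x m * x m))
    ≡⟨ cong₂ (λ a n → (a + (+ 2 * n * (Q - + 1) + Q * (Q * (Q * + 1)) - + 2 * (Q * (Q * + 1)) - + 2 * Q - + 1) * x m)
                        * (Q * (x m * x m)))
             (pos-+ q 3) (trans (pos-+ 1 (2 ℕ.* m)) (cong (λ n → + 1 + n) (pos-* 2 m))) ⟨
      (+ (q ℕ.+ 3) + linPart q N * x m) * (Q * (x m * x m))
    ≡⟨ cong ((+ (q ℕ.+ 3) + linPart q N * x m) *_) powN ⟨
      (+ (q ℕ.+ 3) + linPart q N * x m) * + (q ℕ.^ N) ∎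
    where
    open ≡-Reasoning
    N = 1 ℕ.+ 2 ℕ.* m
    powN : + (q ℕ.^ N) ≡ Q * (x m * x m)
    powN = trans (pos-* q (q ℕ.^ (2 ℕ.* m))) (cong (Q *_) (x-double m))
    cast : + (q ℕ.^ N ℕ.* q ℕ.+ occurrenceBound N) ≡ Q * (x m * x m) * Q + + occurrenceBound N
    cast = trans (pos-+ (q ℕ.^ N ℕ.* q) _) (cong (_+ + occurrenceBound N) (trans (pos-* (q ℕ.^ N) q) (cong (_* Q) powN)))
    expand : ∀ Q x t → (Q * (x * x) * Q + t) * (x * ((Q - + 1) * (Q - + 1)))
                     ≡ x * (Q * (x * x) * Q * (Q - + 1) * (Q - + 1)) + x * ((Q - + 1) * (Q - + 1) * t)
    expand = solve-∀
    collect : ∀ Q x m →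
      x * (Q * (x * x) * Q * (Q - + 1) * (Q - + 1))
        + x * (Q * (Q + + 3) * x + + 2 * (+ 1 + + 2 * m) * (Q - + 1) * Q * x * x - (+ 3 * Q + + 1) * Q * x * x)
      ≡ (Q + + 3 + (+ 2 * (+ 1 + + 2 * m) * (Q - + 1) + Q * (Q * (Q * + 1)) - + 2 * (Q * (Q * + 1)) - + 2 * Q - + 1) * x)
          * (Q * (x * x))
    collect = solve-∀

  totalBound-even : ∀ m → let N = 2 ℕ.* m in
    + (q ℕ.^ N ℕ.* q ℕ.+ occurrenceBound N) * (x m * ((Q - + 1) * (Q - + 1)))
      ≡ (+ (3 ℕ.* q ℕ.+ 1) + linPart q N * x m) * + (q ℕ.^ N)
  totalBound-even m = begin
      + (q ℕ.^ N ℕ.* q ℕ.+ occurrenceBound N) * (x m * ((Q - + 1) * (Q - + 1)))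
    ≡⟨ cong (_* (x m * ((Q - + 1) * (Q - + 1)))) cast ⟩
      (x m * x m * Q + + occurrenceBound N) * (x m * ((Q - + 1) * (Q - + 1)))
    ≡⟨ expand Q (x m) _ ⟩
      x m * (x m * x m * Q * (Q - + 1) * (Q - + 1)) + x m * ((Q - + 1) * (Q - + 1) * + occurrenceBound N)
    ≡⟨ cong (λ c → x m * (x m * x m * Q * (Q - + 1) * (Q - + 1)) + x m * c) (occurrence-even m) ⟩
      x m * (x m * x m * Q * (Q - + 1) * (Q - + 1))
        + x m * ((+ 3 * Q + + 1) * x m + + 4 * + m * (Q - + 1) * x m * x m - (+ 3 * Q + + 1) * x m * x m)
    ≡⟨ collect Q (x m) (+ m) ⟩
      (+ 3 * Q + + 1 + (+ 2 * (+ 2 * + m) * (Q - + 1) + Q * (Q * (Q * + 1)) - + 2 * (Q * (Q * + 1)) - + 2 * Q - + 1) * x m)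
        * (x m * x m)
    ≡⟨ cong₂ (λ a n → (a + (+ 2 * n * (Q - + 1) + Q * (Q * (Q * + 1)) - + 2 * (Q * (Q * + 1)) - + 2 * Q - + 1) * x m)
                        * (x m * x m))
             (trans (pos-+ (3 ℕ.* q) 1) (cong (_+ + 1) (pos-* 3 q))) (pos-* 2 m) ⟨
      (+ (3 ℕ.* q ℕ.+ 1) + linPart q N * x m) * (x m * x m)
    ≡⟨ cong ((+ (3 ℕ.* q ℕ.+ 1) + linPart q N * x m) *_) (x-double m) ⟨
      (+ (3 ℕ.* q ℕ.+ 1) + linPart q N * x m) * + (q ℕ.^ N) ∎
    where
    open ≡-Reasoning
    N = 2 ℕ.* m
    cast : + (q ℕ.^ N ℕ.* q ℕ.+ occurrenceBound N) ≡ x m * x m * Q + + occurrenceBound N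
    cast = trans (pos-+ (q ℕ.^ N ℕ.* q) _) (cong (_+ + occurrenceBound N) (trans (pos-* (q ℕ.^ N) q) (cong (_* Q) (x-double m))))
    expand : ∀ Q x t → (x * x * Q + t) * (x * ((Q - + 1) * (Q - + 1)))
                     ≡ x * (x * x * Q * (Q - + 1) * (Q - + 1)) + x * ((Q - + 1) * (Q - + 1) * t)
    expand = solve-∀
    collect : ∀ Q x m →
      x * (x * x * Q * (Q - + 1) * (Q - + 1))
        + x * ((+ 3 * Q + + 1) * x + + 4 * m * (Q - + 1) * x * x - (+ 3 * Q + + 1) * x * x)
      ≡ (+ 3 * Q + + 1 + (+ 2 * (+ 2 * m) * (Q - + 1) + Q * (Q * (Q * + 1)) - + 2 * (Q * (Q * + 1)) - + 2 * Q - + 1) * x)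
          * (x * x)
    collect = solve-∀

module Fractions where

  open import Data.Nat as ℕ using (ℕ; suc; NonZero)
  open import Data.Integer as ℤ using (ℤ; +_; _+_; _*_)
  import Data.Integer.Properties as ℤ
  import Data.Nat.Properties as ℕₚ
  open import Data.Rational as ℚ using (_/_; toℚᵘ)
  import Data.Rational.Properties as ℚ
  open import Data.Rational.Unnormalised as ℚᵘ using (ℚᵘ; mkℚᵘ; *≤*)
  import Data.Rational.Unnormalised.Properties as ℚᵘ
  open import Relation.Binary.PropositionalEquality

  toℚᵘ-/ : ∀ (n : ℤ) d → toℚᵘ (n / suc d) ℚᵘ.≃ mkℚᵘ n d
  toℚᵘ-/ n d = ℚ.toℚᵘ-fromℚᵘ (mkℚᵘ n d)

  fraction-≤ : ∀ (t B D a e c : ℕ) (l : ℤ) .{{_ : NonZero D}} .{{_ : NonZero e}} .{{_ : NonZero c}} →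
    t ℕ.≤ B → + B * (+ e * + c) ≡ (+ a + l * + e) * + D →
    (+ t / D) ℚ.≤ ((+ a / e) ℚ.+ (l / 1)) ℚ.* (+ 1 / c)
  fraction-≤ t B (suc D) a (suc e) (suc c) l t≤B cross =
    ℚ.toℚᵘ-cancel-≤ (ℚᵘ.≤-respˡ-≃ (ℚᵘ.≃-sym (toℚᵘ-/ (+ t) D))
                      (ℚᵘ.≤-respʳ-≃ (ℚᵘ.≃-sym rhs≃) cross-≤))
    where
    rhsᵘ : ℚᵘ
    rhsᵘ = (mkℚᵘ (+ a) e ℚᵘ.+ mkℚᵘ l 0) ℚᵘ.* mkℚᵘ (+ 1) c
    rhs≃ : toℚᵘ (((+ a / suc e) ℚ.+ (l / 1)) ℚ.* (+ 1 / suc c)) ℚᵘ.≃ rhsᵘ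
    rhs≃ = ℚᵘ.≃-trans (ℚ.toℚᵘ-homo-* ((+ a / suc e) ℚ.+ (l / 1)) (+ 1 / suc c))
             (ℚᵘ.*-cong (ℚᵘ.≃-trans (ℚ.toℚᵘ-homo-+ (+ a / suc e) (l / 1)) (ℚᵘ.+-cong (toℚᵘ-/ (+ a) e) (toℚᵘ-/ l 0)))
                        (toℚᵘ-/ (+ 1) c))
    numerator≡ : ℚᵘ.numerator rhsᵘ ≡ + a + l * + suc e
    numerator≡ = trans (ℤ.*-identityʳ _) (cong (_+ l * + suc e) (ℤ.*-identityʳ (+ a)))
    denominator≡ : ℚᵘ.denominator rhsᵘ ≡ + suc e * + suc c
    denominator≡ = trans (ℤ.pos-* (suc e ℕ.* 1) (suc c)) (cong (λ n → + n * + suc c) (ℕₚ.*-identityʳ (suc e)))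
    cross-≤ : mkℚᵘ (+ t) D ℚᵘ.≤ rhsᵘ
    cross-≤ = *≤* (subst₂ ℤ._≤_ (cong (+ t *_) (sym denominator≡)) (cong (_* + suc D) (sym numerator≡))
                    (ℤ.≤-trans (ℤ.*-monoʳ-≤-nonNeg (+ suc e * + suc c) (ℤ.+≤+ t≤B)) (ℤ.≤-reflexive cross)))

module Bounds (k : ℕ) where

  open import Data.Nat as ℕ using (suc; _^_)
  open import Data.Nat.Properties using (m^n≢0; *-identityʳ)
  open import Data.Integer using (+_; _*_; _-_)
  open import Data.Integer.Properties using (pos-*)
  open import Data.Rational using (_≤_)
  open import Relation.Binary.PropositionalEquality using (_≡_; cong; trans)
  open Fractions using (fraction-≤)

  q : ℕ
  q = suc (suc k)

  open Counting.Averages q using (occurrenceBound; totalP-≤)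
  open ClosedForms q using (totalBound-odd; totalBound-even)

  B : ℕ → ℕ
  B N = q ^ N ℕ.* q ℕ.+ occurrenceBound N

  q-1-squared : + (suc k ^ 2) ≡ (+ q - + 1) * (+ q - + 1)
  q-1-squared = trans (cong (λ n → + (suc k ℕ.* n)) (*-identityʳ (suc k))) (pos-* (suc k) (suc k))

  cross-multiplied : ∀ N m {r} → + B N * (+ (q ^ m) * ((+ q - + 1) * (+ q - + 1))) ≡ r →
                     + B N * (+ (q ^ m) * + (suc k ^ 2)) ≡ r
  cross-multiplied N m = trans (cong (λ c → + B N * (+ (q ^ m) * c)) q-1-squared)

  odd-bound : ∀ m → M q (1 ℕ.+ 2 ℕ.* m) ≤ boundOdd q m
  odd-bound m =
    fraction-≤ (totalP q N) (B N) (q ^ N) (q ℕ.+ 3) (q ^ m) (suc k ^ 2) (linPart q N)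
      {{m^n≢0 q N}} {{m^n≢0 q m}} {{m^n≢0 (suc k) 2}}
      (totalP-≤ N) (cross-multiplied N m (totalBound-odd m))
    where N = 1 ℕ.+ 2 ℕ.* m

  even-bound : ∀ m → M q (2 ℕ.* m) ≤ boundEven q m
  even-bound m =
    fraction-≤ (totalP q N) (B N) (q ^ N) (3 ℕ.* q ℕ.+ 1) (q ^ m) (suc k ^ 2) (linPart q N)
      {{m^n≢0 q N}} {{m^n≢0 q m}} {{m^n≢0 (suc k) 2}}
      (totalP-≤ N) (cross-multiplied N m (totalBound-even m))
    where N = 2 ℕ.* m

open import Data.Nat using (_≤_; _+_; _*_; zero; suc; s≤s)
open import Data.Rational using () renaming (_≤_ to _≤ℚ_)
open import Data.Product using (_×_; _,_)

mainTheorem3 : (q : ℕ) → 2 ≤ q →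
    ((m : ℕ) → M q (1 + 2 * m) ≤ℚ boundOdd q m)
    × ((m : ℕ) → 1 ≤ m → M q (2 * m) ≤ℚ boundEven q m)
mainTheorem3 (suc (suc k)) _ = Bounds.odd-bound k , λ m _ → Bounds.even-bound k m
mainTheorem3 (suc zero) (s≤s ())
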